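{- Let $a,b,a',b'$ be non-negative integers. If $T(a',b')$ is cospectral to $T(a,b)$ (with respect to distance spectra), then $T(a',b')\cong T(a,b)$.
   Context: All graphs are finite, simple, undirected and connected. The distance matrix of a connected graph is the matrix of pairwise graph distances between its vertices; its eigenvalues (with multiplicity) form the distance spectrum, and two graphs are cospectral if their distance spectra coincide. For non-negative integers $a,b$, $T(a,b)$ is the graph obtained from the stars $K_{1,a}$ and $K_{1,b}$ by joining both of their centers to one new common vertex. -}

module Defs where

open import Data.Nat as ℕ using (ℕ; zero; suc; _+_; _≡ᵇ_; _<ᵇ_)
open import Data.Integer as ℤ using (ℤ; +_; -_)
open import Data.Fin using (Fin; zero; suc; toℕ; punchIn)
open import Data.Bool.Properties using (∨-comm)
open import Data.Bool using (Bool; true; false; _∧_; _∨_; if_then_else_)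
open import Data.Product using (Σ; _×_)
open import Function.Bundles using (_↔_; Inverse)
open import Relation.Binary.PropositionalEquality using (_≡_; refl; cong)

record Graph (n : ℕ) : Set where
  field
    adj  : Fin n → Fin n → Bool
    sym  : ∀ u v → adj u v ≡ adj v u
    irr  : ∀ u → adj u u ≡ false
open Graph public

anyFin : ∀ {n} → (Fin n → Bool) → Bool
anyFin {zero}  p = false
anyFin {suc n} p = p zero ∨ anyFin (λ i → p (suc i))

sumFin : ∀ {n} → (Fin n → ℤ) → ℤ
sumFin {zero}  f = + 0
sumFin {suc n} f = f zero ℤ.+ sumFin (λ i → f (suc i))

eqFin : ∀ {n} → Fin n → Fin n → Bool
eqFin u v = toℕ u ≡ᵇ toℕ v

reach : ∀ {n} → Graph n → ℕ → Fin n → Fin n → Bool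
reach G zero    u v = eqFin u v
reach G (suc k) u v = reach G k u v ∨ anyFin (λ w → reach G k u w ∧ adj G w v)

-- graph distance: least k with a walk of length ≤ k (searched up to n;
-- for connected graphs on n vertices the distance is always < n)
dist : ∀ {n} → Graph n → Fin n → Fin n → ℕ
dist {n} G u v = go n 0
  where
  go : ℕ → ℕ → ℕ
  go zero    k = k
  go (suc f) k = if reach G k u v then k else go f (suc k)

distMatrix : ∀ {n} → Graph n → Fin n → Fin n → ℤ
distMatrix G u v = + dist G u v

sign : ℕ → ℤ
sign zero          = + 1
sign (suc zero)    = - (+ 1)
sign (suc (suc k)) = sign k

det : ∀ {n} → (Fin n → Fin n → ℤ) → ℤ
det {zero}  M = + 1
det {suc n} M =
  sumFin (λ j → sign (toℕ j) ℤ.* (M zero j ℤ.* det (λ r c → M (suc r) (punchIn j c))))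

charPolyAt : ∀ {n} → (Fin n → Fin n → ℤ) → ℤ → ℤ
charPolyAt M t = det (λ u v → (if eqFin u v then t else + 0) ℤ.- M u v)

-- distance-cospectral: same order and the same characteristic polynomial of
-- the distance matrix (equality of the integer polynomials, checked as
-- equality of their values at every integer)
DCospectral : ∀ {n m} → Graph n → Graph m → Set
DCospectral {n} {m} G H =
  (n ≡ m) × (∀ t → charPolyAt (distMatrix G) t ≡ charPolyAt (distMatrix H) t)

_≅_ : ∀ {n m} → Graph n → Graph m → Set
_≅_ {n} {m} G H =
  Σ (Fin n ↔ Fin m) λ f → ∀ u v → adj G u v ≡ adj H (Inverse.to f u) (Inverse.to f v)

-- T(a,b): vertex 0 = the common new vertex, 1 = centre of K_{1,a},
-- 2 = centre of K_{1,b}, 3 .. 2+a = leaves of the first star,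
-- 3+a .. 2+a+b = leaves of the second star.

inRange : ℕ → ℕ → ℕ → Bool
inRange lo hi j = (lo ℕ.≤ᵇ j) ∧ (j <ᵇ hi)

Tedge : ℕ → ℕ → ℕ → ℕ → Bool
Tedge a b i j =
     ((i ≡ᵇ 0) ∧ ((j ≡ᵇ 1) ∨ (j ≡ᵇ 2)))
  ∨ ((i ≡ᵇ 1) ∧ inRange 3 (3 + a) j)
  ∨ ((i ≡ᵇ 2) ∧ inRange (3 + a) (3 + a + b) j)

Tadj : (a b : ℕ) → Fin (3 + a + b) → Fin (3 + a + b) → Bool
Tadj a b u v = Tedge a b (toℕ u) (toℕ v) ∨ Tedge a b (toℕ v) (toℕ u)

Tedge-irr : ∀ a b i → Tedge a b i i ≡ false
Tedge-irr a b zero = refl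
Tedge-irr a b (suc zero) = refl
Tedge-irr a b (suc (suc zero)) = refl
Tedge-irr a b (suc (suc (suc k))) = refl

T : (a b : ℕ) → Graph (3 + a + b)
T a b = record
  { adj = Tadj a b
  ; sym = λ u v → ∨-comm (Tedge a b (toℕ u) (toℕ v)) (Tedge a b (toℕ v) (toℕ u))
  ; irr = λ u → cong (λ x → x ∨ x) (Tedge-irr a b (toℕ u))
  }

-- The distance matrix D of a graph on n vertices has zero diagonal, so the coefficient of t^(n-2)
-- in det(t·I - D) is minus the sum of D i j · D j i over the pairs i < j. Characteristic
-- polynomials that agree at every integer agree coefficientwise, so cospectral graphs have equal
-- orders and equal traces of D². The order of T(a,b) is a + b + 3 and
-- trace(D²) = 12 + 24(a+b) + 4(a+b)² + 24ab, so a cospectral T(a',b') has a' + b' = a + b and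
-- a'b' = ab, i.e. {a',b'} = {a,b}; swapping the two stars is an isomorphism T(b,a) ≅ T(a,b).
module Submission where

open import Defs hiding (sym)
open import Data.Nat as ℕ using (ℕ; zero; suc; z≤n; s≤s; _≤_; _<_; _≡ᵇ_; _≤ᵇ_; _<ᵇ_)
import Data.Nat.Properties as ℕₚ
open import Data.Integer as ℤ using (ℤ; +_; -_)
import Data.Integer.Properties as ℤₚ
open import Data.Integer.Tactic.RingSolver using (solve-∀)
open import Data.Fin using (Fin; zero; suc; toℕ)
import Data.Fin.Properties as Finₚ
open import Data.Bool using (Bool; true; false; if_then_else_)
open import Data.Bool.Properties using (T-≡)
open import Data.Product as Product using (Σ-syntax; _×_; _,_; proj₁; proj₂)
open import Data.Sum as Sum using (_⊎_; inj₁; inj₂)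
open import Function using (_∘_)
open import Function.Bundles using (Equivalence)
open import Function.Construct.Identity using (↔-id)
open import Relation.Nullary using (contradiction)
open import Relation.Nullary.Decidable using (dec-false)
open import Relation.Binary.PropositionalEquality
open import Algebra.Properties.AbelianGroup ℤₚ.+-0-abelianGroup using () renaming (∙-cancelˡ to +-cancelˡ)

eqFin⇒≡ : ∀ {n} {u v : Fin n} → eqFin u v ≡ true → u ≡ v
eqFin⇒≡ {u = u} {v} eq = Finₚ.toℕ-injective (ℕₚ.≡ᵇ⇒≡ (toℕ u) (toℕ v) (Equivalence.from T-≡ eq))

eqFin-refl : ∀ {n} (u : Fin n) → eqFin u u ≡ true
eqFin-refl u = Equivalence.to T-≡ (ℕₚ.≡⇒≡ᵇ (toℕ u) (toℕ u) refl)

≡ᵇ-sym : ∀ m n → (m ≡ᵇ n) ≡ (n ≡ᵇ m)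
≡ᵇ-sym zero    zero    = refl
≡ᵇ-sym zero    (suc n) = refl
≡ᵇ-sym (suc m) zero    = refl
≡ᵇ-sym (suc m) (suc n) = ≡ᵇ-sym m n

≤ᵇ-true : ∀ {m n} → m ≤ n → (m ≤ᵇ n) ≡ true
≤ᵇ-true m≤n = Equivalence.to T-≡ (ℕₚ.≤⇒≤ᵇ m≤n)

≤ᵇ-false : ∀ {m n} → n < m → (m ≤ᵇ n) ≡ false
≤ᵇ-false {m} {n} n<m = dec-false (m ℕₚ.≤? n) (ℕₚ.<⇒≱ n<m)

<ᵇ-true : ∀ {m n} → m < n → (m <ᵇ n) ≡ true
<ᵇ-true = ≤ᵇ-true

<ᵇ-false : ∀ {m n} → n ≤ m → (m <ᵇ n) ≡ false
<ᵇ-false n≤m = ≤ᵇ-false (s≤s n≤m)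

module Sums where

  open import Data.Integer using (_+_; _*_; _-_)
  open import Data.Fin using (_↑ˡ_; _↑ʳ_)

  sumFin-cong : ∀ {n} {f g : Fin n → ℤ} → (∀ i → f i ≡ g i) → sumFin f ≡ sumFin g
  sumFin-cong {zero}  f≗g = refl
  sumFin-cong {suc n} f≗g = cong₂ _+_ (f≗g zero) (sumFin-cong (f≗g ∘ suc))

  sumFin-zero : ∀ {n} {f : Fin n → ℤ} → (∀ i → f i ≡ + 0) → sumFin f ≡ + 0
  sumFin-zero {zero}  f≗0 = refl
  sumFin-zero {suc n} f≗0 = cong₂ _+_ (f≗0 zero) (sumFin-zero (f≗0 ∘ suc))

  sumFin-+ : ∀ {n} (f g : Fin n → ℤ) → sumFin (λ i → f i + g i) ≡ sumFin f + sumFin g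
  sumFin-+ {zero}  f g = refl
  sumFin-+ {suc n} f g = trans (cong (_+_ (f zero + g zero)) (sumFin-+ (f ∘ suc) (g ∘ suc)))
                               (interchange (f zero) (g zero) (sumFin (f ∘ suc)) (sumFin (g ∘ suc)))
    where
    interchange : ∀ w x y z → (w + x) + (y + z) ≡ (w + y) + (x + z)
    interchange = solve-∀

  sumFin-neg : ∀ {n} (f : Fin n → ℤ) → sumFin (λ i → - f i) ≡ - sumFin f
  sumFin-neg {zero}  f = refl
  sumFin-neg {suc n} f = trans (cong (_+_ (- f zero)) (sumFin-neg (f ∘ suc)))
                               (sym (ℤₚ.neg-distrib-+ (f zero) (sumFin (f ∘ suc))))

  sumFin-*ˡ : ∀ {n} a (f : Fin n → ℤ) → a * sumFin f ≡ sumFin (λ i → a * f i)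
  sumFin-*ˡ {zero}  a f = ℤₚ.*-zeroʳ a
  sumFin-*ˡ {suc n} a f = trans (ℤₚ.*-distribˡ-+ a (f zero) (sumFin (f ∘ suc)))
                                (cong (_+_ (a * f zero)) (sumFin-*ˡ a (f ∘ suc)))

  sumFin-const : ∀ n x → sumFin {n} (λ _ → x) ≡ + n * x
  sumFin-const zero    x = sym (ℤₚ.*-zeroˡ x)
  sumFin-const (suc n) x = trans (cong (_+_ x) (sumFin-const n x)) (sym (ℤₚ.suc-* (+ n) x))

  sumFin-↑ : ∀ m {n} (f : Fin (m ℕ.+ n) → ℤ) →
    sumFin f ≡ sumFin (λ i → f (i ↑ˡ n)) + sumFin (λ j → f (m ↑ʳ j))
  sumFin-↑ zero    f = sym (ℤₚ.+-identityˡ (sumFin f))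
  sumFin-↑ (suc m) f = trans (cong (_+_ (f zero)) (sumFin-↑ m (f ∘ suc))) (sym (ℤₚ.+-assoc (f zero) _ _))

  sumFin-punctured : ∀ {n} (u : Fin n) (g : Fin n → ℤ) →
    sumFin (λ v → if eqFin u v then + 0 else g v) ≡ sumFin g - g u
  sumFin-punctured zero    g = remove (g zero) (sumFin (g ∘ suc))
    where
    remove : ∀ x s → + 0 + s ≡ (x + s) - x
    remove = solve-∀
  sumFin-punctured (suc u) g =
    trans (cong (_+_ (g zero)) (sumFin-punctured u (g ∘ suc)))
          (shuffle (g zero) (sumFin (g ∘ suc)) (g (suc u)))
    where
    shuffle : ∀ x s y → x + (s - y) ≡ (x + s) - y
    shuffle = solve-∀

open Sums

module Polynomials where

  open import Data.Integer using (_+_; _*_; _-_; ∣_∣; +[1+_])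

  eval : ℕ → (ℕ → ℤ) → ℤ → ℤ
  eval zero    c t = c 0
  eval (suc n) c t = c 0 + t * eval n (c ∘ suc) t

  shift : (ℕ → ℤ) → ℕ → ℤ
  shift c zero    = + 0
  shift c (suc k) = c k

  eval-shift : ∀ n c t → eval (suc n) (shift c) t ≡ t * eval n c t
  eval-shift n c t = ℤₚ.+-identityˡ (t * eval n c t)

  eval-extend : ∀ n (c : ℕ → ℤ) t → (∀ k → n < k → c k ≡ + 0) → eval (suc n) c t ≡ eval n c t
  eval-extend zero    c t c>0≡0 rewrite c>0≡0 1 (s≤s z≤n) | ℤₚ.*-zeroʳ t = ℤₚ.+-identityʳ (c 0)
  eval-extend (suc n) c t c>n≡0 =
    cong (λ y → c 0 + t * y) (eval-extend n (c ∘ suc) t (λ k n<k → c>n≡0 (suc k) (s≤s n<k)))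

  eval-scale : ∀ n s (c : ℕ → ℤ) t → eval n (λ k → s * c k) t ≡ s * eval n c t
  eval-scale zero    s c t = refl
  eval-scale (suc n) s c t =
    trans (cong (λ y → s * c 0 + t * y) (eval-scale n s (c ∘ suc) t))
          (distribute s (c 0) t (eval n (c ∘ suc) t))
    where
    distribute : ∀ s c₀ t C → s * c₀ + t * (s * C) ≡ s * (c₀ + t * C)
    distribute = solve-∀

  eval-linear : ∀ n a b (c d : ℕ → ℤ) t →
    eval n (λ k → a * c k + b * d k) t ≡ a * eval n c t + b * eval n d t
  eval-linear zero    a b c d t = refl
  eval-linear (suc n) a b c d t =
    trans (cong (λ y → a * c 0 + b * d 0 + t * y) (eval-linear n a b (c ∘ suc) (d ∘ suc) t))
          (distribute a b (c 0) (d 0) t (eval n (c ∘ suc) t) (eval n (d ∘ suc) t))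
    where
    distribute : ∀ a b c₀ d₀ t C D →
      a * c₀ + b * d₀ + t * (a * C + b * D) ≡ a * (c₀ + t * C) + b * (d₀ + t * D)
    distribute = solve-∀

  eval-sub : ∀ n (c d : ℕ → ℤ) t → eval n (λ k → c k - d k) t ≡ eval n c t - eval n d t
  eval-sub zero    c d t = refl
  eval-sub (suc n) c d t =
    trans (cong (λ y → c 0 - d 0 + t * y) (eval-sub n (c ∘ suc) (d ∘ suc) t))
          (distribute (c 0) (d 0) t (eval n (c ∘ suc) t) (eval n (d ∘ suc) t))
    where
    distribute : ∀ c₀ d₀ t C D → c₀ - d₀ + t * (C - D) ≡ (c₀ + t * C) - (d₀ + t * D)
    distribute = solve-∀

  eval-sum : ∀ n {m} (f : Fin m → ℕ → ℤ) t →
    eval n (λ k → sumFin (λ j → f j k)) t ≡ sumFin (λ j → eval n (f j) t)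
  eval-sum zero    f t = refl
  eval-sum (suc n) f t = begin
    sumFin (λ j → f j 0) + t * eval n (λ k → sumFin (λ j → f j (suc k))) t
      ≡⟨ cong (λ y → sumFin (λ j → f j 0) + t * y) (eval-sum n (λ j → f j ∘ suc) t) ⟩
    sumFin (λ j → f j 0) + t * sumFin (λ j → eval n (f j ∘ suc) t)
      ≡⟨ cong (_+_ (sumFin (λ j → f j 0))) (sumFin-*ˡ t (λ j → eval n (f j ∘ suc) t)) ⟩
    sumFin (λ j → f j 0) + sumFin (λ j → t * eval n (f j ∘ suc) t)
      ≡⟨ sumFin-+ (λ j → f j 0) (λ j → t * eval n (f j ∘ suc) t) ⟨
    sumFin (λ j → eval (suc n) (f j) t) ∎
    where open ≡-Reasoning

  multiple-≤-zero : ∀ m x q → x + +[1+ m ] * q ≡ + 0 → ∣ x ∣ ≤ m → x ≡ + 0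
  multiple-≤-zero m x q x+[1+m]q≡0 ∣x∣≤m = ℤₚ.∣i∣≡0⇒i≡0 (vanishes ∣ q ∣ ∣x∣≡[1+m]∣q∣)
    where
    cancel : ∀ x y → x ≡ (x + y) - y
    cancel = solve-∀
    ∣x∣≡[1+m]∣q∣ : ∣ x ∣ ≡ suc m ℕ.* ∣ q ∣
    ∣x∣≡[1+m]∣q∣ = begin
      ∣ x ∣                                ≡⟨ cong ∣_∣ (cancel x (+[1+ m ] * q)) ⟩
      ∣ x + +[1+ m ] * q - +[1+ m ] * q ∣  ≡⟨ cong (λ y → ∣ y - +[1+ m ] * q ∣) x+[1+m]q≡0 ⟩
      ∣ + 0 - +[1+ m ] * q ∣               ≡⟨ cong ∣_∣ (ℤₚ.+-identityˡ (- (+[1+ m ] * q))) ⟩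
      ∣ - (+[1+ m ] * q) ∣                 ≡⟨ ℤₚ.∣-i∣≡∣i∣ (+[1+ m ] * q) ⟩
      ∣ +[1+ m ] * q ∣                     ≡⟨ ℤₚ.abs-* +[1+ m ] q ⟩
      suc m ℕ.* ∣ q ∣                      ∎
      where open ≡-Reasoning
    vanishes : ∀ k → ∣ x ∣ ≡ suc m ℕ.* k → ∣ x ∣ ≡ 0
    vanishes zero    eq = trans eq (ℕₚ.*-zeroʳ m)
    vanishes (suc k) eq = contradiction (ℕₚ.≤-trans (ℕₚ.m≤m*n (suc m) (suc k)) (ℕₚ.≤-reflexive (sym eq)))
                                        (ℕₚ.<⇒≱ (s≤s ∣x∣≤m))

  -- At t = |c 0| + 1 the constant term is a multiple of t of smaller absolute value.
  eval-vanishing : ∀ n (c : ℕ → ℤ) → (∀ m → eval n c +[1+ m ] ≡ + 0) → ∀ k → k ≤ n → c k ≡ + 0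
  eval-vanishing zero    c c≡0 zero _ = c≡0 0
  eval-vanishing (suc n) c c≡0 = coefficient
    where
    c₀≡0 : c 0 ≡ + 0
    c₀≡0 = multiple-≤-zero ∣ c 0 ∣ (c 0) (eval n (c ∘ suc) +[1+ ∣ c 0 ∣ ]) (c≡0 ∣ c 0 ∣) ℕₚ.≤-refl
    product≡0 : ∀ m → +[1+ m ] * eval n (c ∘ suc) +[1+ m ] ≡ + 0
    product≡0 m = trans (sym (ℤₚ.+-identityˡ _))
      (trans (cong (λ c₀ → c₀ + +[1+ m ] * eval n (c ∘ suc) +[1+ m ]) (sym c₀≡0)) (c≡0 m))
    tail≡0 : ∀ m → eval n (c ∘ suc) +[1+ m ] ≡ + 0
    tail≡0 m with ℤₚ.i*j≡0⇒i≡0∨j≡0 +[1+ m ] (product≡0 m)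
    ... | inj₂ tail≡0 = tail≡0
    coefficient : ∀ k → k ≤ suc n → c k ≡ + 0
    coefficient zero    _         = c₀≡0
    coefficient (suc k) (s≤s k≤n) = eval-vanishing n (c ∘ suc) tail≡0 k k≤n

  eval-injective : ∀ n (c d : ℕ → ℤ) → (∀ t → eval n c t ≡ eval n d t) → ∀ k → k ≤ n → c k ≡ d k
  eval-injective n c d c≐d k k≤n =
    ℤₚ.i-j≡0⇒i≡j (c k) (d k) (eval-vanishing n (λ k → c k - d k) difference≡0 k k≤n)
    where
    difference≡0 : ∀ m → eval n (λ k → c k - d k) +[1+ m ] ≡ + 0
    difference≡0 m = trans (eval-sub n c d +[1+ m ])
      (trans (cong (_- eval n d +[1+ m ]) (c≐d +[1+ m ])) (ℤₚ.+-inverseʳ (eval n d +[1+ m ])))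

open Polynomials

module Determinants where

  open import Data.Integer using (_+_; _*_; _-_)
  open import Data.Fin using (punchIn)

  Matrix : ℕ → Set
  Matrix n = Fin n → Fin n → ℤ

  minor : ∀ {n} → Matrix (suc n) → Fin (suc n) → Matrix n
  minor M j r c = M (suc r) (punchIn j c)

  det-cong : ∀ {n} {M N : Matrix n} → (∀ r c → M r c ≡ N r c) → det M ≡ det N
  det-cong {zero}  M≗N = refl
  det-cong {suc n} M≗N = sumFin-cong λ j →
    cong₂ (λ x y → sign (toℕ j) * (x * y)) (M≗N zero j) (det-cong (λ r c → M≗N (suc r) (punchIn j c)))

  pencilCoeff : ∀ {n} → Matrix n → Matrix n → ℕ → ℤ
  pencilCoeff {zero}  α β zero    = + 1
  pencilCoeff {zero}  α β (suc k) = + 0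
  pencilCoeff {suc n} α β k = sumFin λ j →
    sign (toℕ j) * (α zero j * pencilCoeff (minor α j) (minor β j) k
                    + β zero j * shift (pencilCoeff (minor α j) (minor β j)) k)

  freeRows : ∀ {n} → (Fin n → Bool) → ℕ
  freeRows {zero}  z = 0
  freeRows {suc n} z = (if z zero then 0 else 1) ℕ.+ freeRows (z ∘ suc)

  freeRows-none : ∀ n → freeRows {n} (λ _ → false) ≡ n
  freeRows-none zero    = refl
  freeRows-none (suc n) = cong suc (freeRows-none n)

  freeRows-allBut : ∀ {m} (p : Fin (suc m)) → freeRows (λ r → eqFin r p) ≡ m
  freeRows-allBut {m}     zero    = freeRows-none m
  freeRows-allBut {suc m} (suc p) = cong suc (freeRows-allBut p)

  rowMix : ∀ {n} → (Fin n → Bool) → Matrix n → Matrix n → Matrix n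
  rowMix z α β i c = if z i then α i c else β i c

  VanishesOn : ∀ {n} → (Fin n → Bool) → Matrix n → Set
  VanishesOn z β = ∀ i c → z i ≡ true → β i c ≡ + 0

  minor-vanishesOn : ∀ {n} {z : Fin (suc n) → Bool} {β} → VanishesOn z β →
    ∀ j → VanishesOn (z ∘ suc) (minor β j)
  minor-vanishesOn β-vanishes j i c = β-vanishes (suc i) (punchIn j c)

  pencilCoeff-degree : ∀ {n} (z : Fin n → Bool) (α β : Matrix n) → VanishesOn z β →
    ∀ k → freeRows z < k → pencilCoeff α β k ≡ + 0
  pencilCoeff-degree {zero} z α β _ (suc k) _ = refl
  pencilCoeff-degree {suc n} z α β β-vanishes k free<k with z zero in z₀
  ... | true = sumFin-zero λ j →
    trans (cong₂ (λ x y → sign (toℕ j) * (α zero j * x + y * shift (C j) k))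
                 (degree j k free<k) (β-vanishes zero j z₀))
          (vanish (sign (toℕ j)) (α zero j) (shift (C j) k))
    where
    C : Fin (suc n) → ℕ → ℤ
    C j = pencilCoeff (minor α j) (minor β j)
    degree : ∀ j k → freeRows (z ∘ suc) < k → C j k ≡ + 0
    degree j = pencilCoeff-degree (z ∘ suc) (minor α j) (minor β j) (minor-vanishesOn β-vanishes j)
    vanish : ∀ s a y → s * (a * + 0 + + 0 * y) ≡ + 0
    vanish = solve-∀
  ... | false with k | free<k
  ...   | suc k | s≤s free<k = sumFin-zero λ j →
    trans (cong₂ (λ x y → sign (toℕ j) * (α zero j * x + β zero j * y))
                 (degree j (suc k) (ℕₚ.m<n⇒m<1+n free<k)) (degree j k free<k))
          (vanish (sign (toℕ j)) (α zero j) (β zero j))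
    where
    C : Fin (suc n) → ℕ → ℤ
    C j = pencilCoeff (minor α j) (minor β j)
    degree : ∀ j k → freeRows (z ∘ suc) < k → C j k ≡ + 0
    degree j = pencilCoeff-degree (z ∘ suc) (minor α j) (minor β j) (minor-vanishesOn β-vanishes j)
    vanish : ∀ s a b → s * (a * + 0 + b * + 0) ≡ + 0
    vanish = solve-∀

  pencilCoeff-leading : ∀ {n} (z : Fin n → Bool) (α β : Matrix n) → VanishesOn z β →
    pencilCoeff α β (freeRows z) ≡ det (rowMix z α β)
  pencilCoeff-leading {zero} z α β _ = refl
  pencilCoeff-leading {suc n} z α β β-vanishes with z zero in z₀
  ... | true = sumFin-cong λ j →
    trans (cong₂ (λ x y → sign (toℕ j) * (α zero j * x + y * shift (C j) (freeRows (z ∘ suc))))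
                 (leading j) (β-vanishes zero j z₀))
          (drop (sign (toℕ j)) (α zero j) (det (rowMix (z ∘ suc) (minor α j) (minor β j)))
                (shift (C j) (freeRows (z ∘ suc))))
    where
    C : Fin (suc n) → ℕ → ℤ
    C j = pencilCoeff (minor α j) (minor β j)
    leading : ∀ j → C j (freeRows (z ∘ suc)) ≡ det (rowMix (z ∘ suc) (minor α j) (minor β j))
    leading j = pencilCoeff-leading (z ∘ suc) (minor α j) (minor β j) (minor-vanishesOn β-vanishes j)
    drop : ∀ s a D y → s * (a * D + + 0 * y) ≡ s * (a * D)
    drop = solve-∀
  ... | false = sumFin-cong λ j →
    trans (cong₂ (λ x y → sign (toℕ j) * (α zero j * x + β zero j * y))
                 (pencilCoeff-degree (z ∘ suc) (minor α j) (minor β j) (minor-vanishesOn β-vanishes j)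
                                     (suc (freeRows (z ∘ suc))) ℕₚ.≤-refl)
                 (pencilCoeff-leading (z ∘ suc) (minor α j) (minor β j) (minor-vanishesOn β-vanishes j)))
          (drop (sign (toℕ j)) (α zero j) (β zero j) (det (rowMix (z ∘ suc) (minor α j) (minor β j))))
    where
    drop : ∀ s a b D → s * (a * + 0 + b * D) ≡ s * (b * D)
    drop = solve-∀

  det-pencil : ∀ {n} (α β : Matrix n) t → det (λ u v → α u v + t * β u v) ≡ eval n (pencilCoeff α β) t
  det-pencil {zero}  α β t = refl
  det-pencil {suc n} α β t = sym (begin
    eval (suc n) (pencilCoeff α β) t
      ≡⟨ eval-sum (suc n) (λ j k → sign (toℕ j) * (α zero j * C j k + β zero j * shift (C j) k)) t ⟩
    sumFin (λ j → eval (suc n) (λ k → sign (toℕ j) * (α zero j * C j k + β zero j * shift (C j) k)) t)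
      ≡⟨ sumFin-cong expand ⟩
    sumFin (λ j → sign (toℕ j) * ((α zero j + t * β zero j) * det (pencil j))) ∎)
    where
    open ≡-Reasoning
    C : Fin (suc n) → ℕ → ℤ
    C j = pencilCoeff (minor α j) (minor β j)
    pencil : Fin (suc n) → Matrix n
    pencil j u v = minor α j u v + t * minor β j u v
    C-degree : ∀ j k → n < k → C j k ≡ + 0
    C-degree j k n<k = pencilCoeff-degree (λ _ → false) (minor α j) (minor β j) (λ _ _ ()) k
                         (subst (_< k) (sym (freeRows-none n)) n<k)
    factor : ∀ s a b t P → s * (a * P + b * (t * P)) ≡ s * ((a + t * b) * P)
    factor = solve-∀
    expand : ∀ j → eval (suc n) (λ k → sign (toℕ j) * (α zero j * C j k + β zero j * shift (C j) k)) t
                 ≡ sign (toℕ j) * ((α zero j + t * β zero j) * det (pencil j))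
    expand j = begin
      eval (suc n) (λ k → s * (a * C j k + b * shift (C j) k)) t
        ≡⟨ eval-scale (suc n) s (λ k → a * C j k + b * shift (C j) k) t ⟩
      s * eval (suc n) (λ k → a * C j k + b * shift (C j) k) t
        ≡⟨ cong (s *_) (eval-linear (suc n) a b (C j) (shift (C j)) t) ⟩
      s * (a * eval (suc n) (C j) t + b * eval (suc n) (shift (C j)) t)
        ≡⟨ cong₂ (λ x y → s * (a * x + b * y)) (eval-extend n (C j) t (C-degree j)) (eval-shift n (C j) t) ⟩
      s * (a * eval n (C j) t + b * (t * eval n (C j) t))
        ≡⟨ factor s a b t (eval n (C j) t) ⟩
      s * ((a + t * b) * eval n (C j) t)
        ≡⟨ cong (λ d → s * ((a + t * b) * d)) (det-pencil (minor α j) (minor β j) t) ⟨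
      s * ((a + t * b) * det (pencil j)) ∎
      where
      s = sign (toℕ j)
      a = α zero j
      b = β zero j

  idMatrix : ∀ {n} → Matrix n
  idMatrix u v = if eqFin u v then + 1 else + 0

  replaceRow : ∀ {n} → Matrix n → Fin n → (Fin n → ℤ) → Matrix n
  replaceRow M p v r c = if eqFin r p then v c else M r c

  sign-suc : ∀ k → sign (suc k) ≡ - sign k
  sign-suc zero          = refl
  sign-suc (suc zero)    = refl
  sign-suc (suc (suc k)) = sign-suc k

  sign-square : ∀ k → sign k * sign k ≡ + 1
  sign-square zero          = refl
  sign-square (suc zero)    = refl
  sign-square (suc (suc k)) = sign-square k

  det-by-row : ∀ {n} (M : Matrix (suc n)) → (∀ j → M zero j * det (minor M j) ≡ + 0) → det M ≡ + 0
  det-by-row M term≡0 = sumFin-zero λ j → trans (cong (sign (toℕ j) *_) (term≡0 j)) (ℤₚ.*-zeroʳ (sign (toℕ j)))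

  det-zeroColumn : ∀ {n} (M : Matrix (suc n)) → (∀ r → M r zero ≡ + 0) → det M ≡ + 0
  det-zeroColumn {zero}  M col≡0 = det-by-row M λ { zero → cong (_* + 1) (col≡0 zero) }
  det-zeroColumn {suc n} M col≡0 = det-by-row M λ
    { zero    → trans (cong (_* det (minor M zero)) (col≡0 zero)) (ℤₚ.*-zeroˡ (det (minor M zero)))
    ; (suc j) → trans (cong (M zero (suc j) *_) (det-zeroColumn (minor M (suc j)) (col≡0 ∘ suc)))
                      (ℤₚ.*-zeroʳ (M zero (suc j)))
    }

  det-zeroColumnBelow : ∀ {n} (M : Matrix (suc n)) → (∀ r → M (suc r) zero ≡ + 0) →
    det M ≡ M zero zero * det (minor M zero)
  det-zeroColumnBelow {zero}  M _      = unit (M zero zero * + 1)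
    where
    unit : ∀ x → + 1 * x + + 0 ≡ x
    unit = solve-∀
  det-zeroColumnBelow {suc n} M col≡0 =
    trans (cong (_+_ (+ 1 * (M zero zero * det (minor M zero)))) (sumFin-zero later≡0))
          (unit (M zero zero * det (minor M zero)))
    where
    unit : ∀ x → + 1 * x + + 0 ≡ x
    unit = solve-∀
    vanish : ∀ s a → s * (a * + 0) ≡ + 0
    vanish = solve-∀
    later≡0 : ∀ j → sign (toℕ (suc j)) * (M zero (suc j) * det (minor M (suc j))) ≡ + 0
    later≡0 j = trans (cong (λ d → sign (toℕ (suc j)) * (M zero (suc j) * d))
                            (det-zeroColumn (minor M (suc j)) col≡0))
                      (vanish (sign (toℕ (suc j))) (M zero (suc j)))

  det-idMatrix : ∀ n → det (idMatrix {n}) ≡ + 1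
  det-idMatrix zero    = refl
  det-idMatrix (suc n) =
    trans (det-zeroColumnBelow (idMatrix {suc n}) (λ _ → refl))
          (cong (+ 1 *_) (trans (det-cong {M = minor idMatrix zero} {N = idMatrix {n}} (λ _ _ → refl))
                                (det-idMatrix n)))

  -- Rows before p of this matrix are the unit rows e (r + 1), rows after p are e r.
  det-replaceRow-minorId : ∀ {k} (p : Fin (suc k)) v →
    det (replaceRow (minor (idMatrix {suc (suc k)}) (suc p)) p v) ≡ sign (toℕ p) * v zero
  det-replaceRow-minorId {k} zero v = begin
    det M                        ≡⟨ det-zeroColumnBelow M (λ _ → refl) ⟩
    v zero * det (minor M zero)  ≡⟨ cong (v zero *_) (det-cong {N = idMatrix {k}} (λ _ _ → refl)) ⟩
    v zero * det (idMatrix {k})  ≡⟨ cong (v zero *_) (det-idMatrix k) ⟩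
    v zero * + 1                 ≡⟨ ℤₚ.*-identityʳ (v zero) ⟩
    v zero                       ≡⟨ ℤₚ.*-identityˡ (v zero) ⟨
    + 1 * v zero                 ∎
    where
    open ≡-Reasoning
    M = replaceRow (minor (idMatrix {suc (suc k)}) (suc zero)) zero v
  det-replaceRow-minorId {suc k} (suc p) v = begin
    det M
      ≡⟨ cong₂ (λ d₁ rest → + 1 * (+ 0 * d₀) + (- + 1 * (+ 1 * d₁) + rest))
               (trans (det-cong minor₁) (det-replaceRow-minorId p (v ∘ punchIn (suc zero))))
               (sumFin-zero {k} later≡0) ⟩
    + 1 * (+ 0 * d₀) + (- + 1 * (+ 1 * (sign (toℕ p) * v zero)) + + 0)
      ≡⟨ simplify d₀ (sign (toℕ p)) (v zero) ⟩
    - sign (toℕ p) * v zero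
      ≡⟨ cong (_* v zero) (sign-suc (toℕ p)) ⟨
    sign (toℕ (suc p)) * v zero ∎
    where
    open ≡-Reasoning
    M = replaceRow (minor (idMatrix {suc (suc (suc k))}) (suc (suc p))) (suc p) v
    d₀ = det (minor M zero)
    minor₁ : ∀ r c → minor M (suc zero) r c ≡ replaceRow (minor idMatrix (suc p)) p (v ∘ punchIn (suc zero)) r c
    minor₁ r zero    = refl
    minor₁ r (suc c) = refl
    later≡0 : ∀ j → sign (toℕ (suc (suc j))) * (+ 0 * det (minor M (suc (suc j)))) ≡ + 0
    later≡0 j = trans (cong (sign (toℕ (suc (suc j))) *_) (ℤₚ.*-zeroˡ (det (minor M (suc (suc j))))))
                      (ℤₚ.*-zeroʳ (sign (toℕ (suc (suc j)))))
    simplify : ∀ d s w → + 1 * (+ 0 * d) + (- + 1 * (+ 1 * (s * w)) + + 0) ≡ - s * w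
    simplify = solve-∀

  minorId-vanishesOn : ∀ {m} (p : Fin (suc m)) →
    VanishesOn (λ r → eqFin r p) (minor (idMatrix {suc (suc m)}) (suc p))
  minorId-vanishesOn p r c r≡p with eqFin (suc r) (punchIn (suc p) c) in e
  ... | false = refl
  ... | true  = contradiction (trans (sym (eqFin⇒≡ e)) (cong suc (eqFin⇒≡ r≡p))) (Finₚ.punchInᵢ≢i (suc p) c)

  rowMix-replaceRow : ∀ {n} (p : Fin n) (α β : Matrix n) r c →
    rowMix (λ r → eqFin r p) α β r c ≡ replaceRow β p (α p) r c
  rowMix-replaceRow p α β r c with eqFin r p in e
  ... | true  = cong (λ r → α r c) (eqFin⇒≡ e)
  ... | false = refl

  -- Deleting row 0 and column p+1 of α + t·I removes the t of row p+1, so the top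
  -- coefficient of this minor picks α (p+1) 0 from that row and t from every other row.
  minorId-leading : ∀ {m} (α : Matrix (suc (suc m))) (p : Fin (suc m)) →
    pencilCoeff (minor α (suc p)) (minor idMatrix (suc p)) m ≡ sign (toℕ p) * α (suc p) zero
  minorId-leading {m} α p = begin
    pencilCoeff α′ I′ m
      ≡⟨ cong (pencilCoeff α′ I′) (freeRows-allBut p) ⟨
    pencilCoeff α′ I′ (freeRows (λ r → eqFin r p))
      ≡⟨ pencilCoeff-leading (λ r → eqFin r p) α′ I′ (minorId-vanishesOn p) ⟩
    det (rowMix (λ r → eqFin r p) α′ I′)
      ≡⟨ det-cong (rowMix-replaceRow p α′ I′) ⟩
    det (replaceRow I′ p (α′ p))
      ≡⟨ det-replaceRow-minorId p (α′ p) ⟩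
    sign (toℕ p) * α (suc p) zero ∎
    where
    open ≡-Reasoning
    α′ = minor α (suc p)
    I′ = minor idMatrix (suc p)

  minorId-term : ∀ {m} (α : Matrix (suc (suc m))) (p : Fin (suc m)) y →
    sign (toℕ (suc p)) * (α zero (suc p) * pencilCoeff (minor α (suc p)) (minor idMatrix (suc p)) m + + 0 * y)
      ≡ - (α zero (suc p) * α (suc p) zero)
  minorId-term {m} α p y = begin
    sign (toℕ (suc p)) * (a * pencilCoeff (minor α (suc p)) (minor idMatrix (suc p)) m + + 0 * y)
      ≡⟨ cong₂ (λ s x → s * (a * x + + 0 * y)) (sign-suc (toℕ p)) (minorId-leading α p) ⟩
    - sign (toℕ p) * (a * (sign (toℕ p) * b) + + 0 * y)
      ≡⟨ rearrange (sign (toℕ p)) a b y ⟩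
    - (a * b) * (sign (toℕ p) * sign (toℕ p))
      ≡⟨ cong (- (a * b) *_) (sign-square (toℕ p)) ⟩
    - (a * b) * + 1
      ≡⟨ ℤₚ.*-identityʳ (- (a * b)) ⟩
    - (a * b) ∎
    where
    open ≡-Reasoning
    a = α zero (suc p)
    b = α (suc p) zero
    rearrange : ∀ s a b y → - s * (a * (s * b) + + 0 * y) ≡ - (a * b) * (s * s)
    rearrange = solve-∀

  Hollow : ∀ {n} → Matrix n → Set
  Hollow M = ∀ i → M i i ≡ + 0

  pairProductSum : ∀ {n} → Matrix n → ℤ
  pairProductSum {zero}  M = + 0
  pairProductSum {suc n} M = sumFin (λ j → M zero (suc j) * M (suc j) zero) + pairProductSum (minor M zero)

  pencilCoeff-subleading : ∀ m (α : Matrix (suc (suc m))) → Hollow α →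
    pencilCoeff α idMatrix m ≡ - pairProductSum α
  pencilCoeff-subleading m α hollow = begin
    pencilCoeff α idMatrix m
      ≡⟨ cong₂ _+_ diagonalTerm (sumFin-cong offDiagonalTerm) ⟩
    - pairProductSum α′ + sumFin (λ p → - (α zero (suc p) * α (suc p) zero))
      ≡⟨ cong (_+_ (- pairProductSum α′)) (sumFin-neg (λ p → α zero (suc p) * α (suc p) zero)) ⟩
    - pairProductSum α′ + - sumFin (λ p → α zero (suc p) * α (suc p) zero)
      ≡⟨ negate (pairProductSum α′) (sumFin (λ p → α zero (suc p) * α (suc p) zero)) ⟩
    - pairProductSum α ∎
    where
    open ≡-Reasoning
    α′ = minor α zero
    negate : ∀ x y → - x + - y ≡ - (y + x)
    negate = solve-∀
    simplify : ∀ x y → + 1 * (+ 0 * x + + 1 * y) ≡ y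
    simplify = solve-∀
    lower : ∀ m (α : Matrix (suc (suc m))) → Hollow α →
      shift (pencilCoeff (minor α zero) idMatrix) m ≡ - pairProductSum (minor α zero)
    lower zero    α hollow = refl
    lower (suc m) α hollow = pencilCoeff-subleading m (minor α zero) (hollow ∘ suc)
    C′ : ℕ → ℤ
    C′ = pencilCoeff α′ idMatrix
    diagonalTerm : sign 0 * (α zero zero * C′ m + + 1 * shift C′ m) ≡ - pairProductSum α′
    diagonalTerm = begin
      + 1 * (α zero zero * C′ m + + 1 * shift C′ m)
        ≡⟨ cong (λ x → + 1 * (x * C′ m + + 1 * shift C′ m)) (hollow zero) ⟩
      + 1 * (+ 0 * C′ m + + 1 * shift C′ m)
        ≡⟨ simplify (C′ m) (shift C′ m) ⟩
      shift C′ m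
        ≡⟨ lower m α hollow ⟩
      - pairProductSum α′ ∎
    offDiagonalTerm : ∀ p →
      sign (toℕ (suc p)) * (α zero (suc p) * pencilCoeff (minor α (suc p)) (minor idMatrix (suc p)) m
                            + + 0 * shift (pencilCoeff (minor α (suc p)) (minor idMatrix (suc p))) m)
        ≡ - (α zero (suc p) * α (suc p) zero)
    offDiagonalTerm p = minorId-term α p (shift (pencilCoeff (minor α (suc p)) (minor idMatrix (suc p))) m)

  charPolyAt-pencil : ∀ {n} (M : Matrix n) t →
    charPolyAt M t ≡ eval n (pencilCoeff (λ u v → - M u v) idMatrix) t
  charPolyAt-pencil M t = trans (det-cong entry) (det-pencil (λ u v → - M u v) idMatrix t)
    where
    onDiagonal : ∀ t x → t - x ≡ - x + t * + 1
    onDiagonal = solve-∀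
    offDiagonal : ∀ t x → + 0 - x ≡ - x + t * + 0
    offDiagonal = solve-∀
    entry : ∀ u v → (if eqFin u v then t else + 0) - M u v ≡ - M u v + t * idMatrix u v
    entry u v with eqFin u v
    ... | true  = onDiagonal t (M u v)
    ... | false = offDiagonal t (M u v)

  pairProductSum-neg : ∀ {n} (M : Matrix n) → pairProductSum (λ u v → - M u v) ≡ pairProductSum M
  pairProductSum-neg {zero}  M = refl
  pairProductSum-neg {suc n} M =
    cong₂ _+_ (sumFin-cong λ j → neg*neg (M zero (suc j)) (M (suc j) zero)) (pairProductSum-neg (minor M zero))
    where
    neg*neg : ∀ x y → - x * - y ≡ x * y
    neg*neg = solve-∀

  traceOfSquare : ∀ {n} → Matrix n → ℤ
  traceOfSquare M = sumFin λ i → sumFin λ j → M i j * M j i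

  traceOfSquare-hollow : ∀ {n} (M : Matrix n) → Hollow M → traceOfSquare M ≡ pairProductSum M + pairProductSum M
  traceOfSquare-hollow {zero}  M hollow = refl
  traceOfSquare-hollow {suc n} M hollow = begin
    traceOfSquare M
      ≡⟨ cong (_+_ (M zero zero * M zero zero + A)) (sumFin-+ (λ i → M (suc i) zero * M zero (suc i)) _) ⟩
    (M zero zero * M zero zero + A)
      + (sumFin (λ i → M (suc i) zero * M zero (suc i)) + traceOfSquare (minor M zero))
      ≡⟨ cong₂ (λ d rest → (d * d + A) + rest) (hollow zero)
               (cong₂ _+_ (sumFin-cong λ i → ℤₚ.*-comm (M (suc i) zero) (M zero (suc i)))
                          (traceOfSquare-hollow (minor M zero) (hollow ∘ suc))) ⟩
    (+ 0 * + 0 + A) + (A + (P + P))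
      ≡⟨ regroup A P ⟩
    (A + P) + (A + P) ∎
    where
    open ≡-Reasoning
    A = sumFin (λ j → M zero (suc j) * M (suc j) zero)
    P = pairProductSum (minor M zero)
    regroup : ∀ A P → (+ 0 * + 0 + A) + (A + (P + P)) ≡ (A + P) + (A + P)
    regroup = solve-∀

  charPoly≡⇒traceOfSquare≡ : ∀ {m n} (M : Matrix (suc (suc m))) (N : Matrix (suc (suc n))) → m ≡ n →
    Hollow M → Hollow N → (∀ t → charPolyAt M t ≡ charPolyAt N t) → traceOfSquare M ≡ traceOfSquare N
  charPoly≡⇒traceOfSquare≡ {m} M N refl M-hollow N-hollow χ≡ = begin
    traceOfSquare M                      ≡⟨ traceOfSquare-hollow M M-hollow ⟩
    pairProductSum M + pairProductSum M  ≡⟨ cong (λ x → x + x) pairs≡ ⟩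
    pairProductSum N + pairProductSum N  ≡⟨ traceOfSquare-hollow N N-hollow ⟨
    traceOfSquare N                      ∎
    where
    open ≡-Reasoning
    -M -N : Matrix (suc (suc m))
    -M u v = - M u v
    -N u v = - N u v
    coefficients≡ : ∀ k → k ≤ suc (suc m) → pencilCoeff -M idMatrix k ≡ pencilCoeff -N idMatrix k
    coefficients≡ = eval-injective (suc (suc m)) _ _ λ t →
      trans (sym (charPolyAt-pencil M t)) (trans (χ≡ t) (charPolyAt-pencil N t))
    pairs≡ : pairProductSum M ≡ pairProductSum N
    pairs≡ = begin
      pairProductSum M   ≡⟨ pairProductSum-neg M ⟨
      pairProductSum -M  ≡⟨ ℤₚ.neg-injective (begin
          - pairProductSum -M        ≡⟨ pencilCoeff-subleading m -M (cong -_ ∘ M-hollow) ⟨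
          pencilCoeff -M idMatrix m  ≡⟨ coefficients≡ m (ℕₚ.m≤n+m m 2) ⟩
          pencilCoeff -N idMatrix m  ≡⟨ pencilCoeff-subleading m -N (cong -_ ∘ N-hollow) ⟩
          - pairProductSum -N        ∎) ⟩
      pairProductSum -N  ≡⟨ pairProductSum-neg N ⟩
      pairProductSum N   ∎

open Determinants

module Distances where

  open import Data.Bool using (_∧_; _∨_)
  open import Data.Bool.Properties using (∨-zeroʳ; ∧-zeroʳ)
  open import Relation.Binary.Definitions using (Tri; tri<; tri≈; tri>)

  anyFin-true : ∀ {n} (p : Fin n → Bool) w → p w ≡ true → anyFin p ≡ true
  anyFin-true p zero    pw = cong (_∨ anyFin (p ∘ suc)) pw
  anyFin-true p (suc w) pw = trans (cong (p zero ∨_) (anyFin-true (p ∘ suc) w pw)) (∨-zeroʳ (p zero))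

  anyFin-false : ∀ {n} (p : Fin n → Bool) → (∀ w → p w ≡ false) → anyFin p ≡ false
  anyFin-false {zero}  p _   = refl
  anyFin-false {suc n} p p≡f = cong₂ _∨_ (p≡f zero) (anyFin-false (p ∘ suc) (p≡f ∘ suc))

  anyFin-cong : ∀ {n} {p q : Fin n → Bool} → (∀ w → p w ≡ q w) → anyFin p ≡ anyFin q
  anyFin-cong {zero}  p≗q = refl
  anyFin-cong {suc n} p≗q = cong₂ _∨_ (p≗q zero) (anyFin-cong (p≗q ∘ suc))

  if-true : ∀ {b} {x y : ℕ} → b ≡ true → (if b then x else y) ≡ x
  if-true refl = refl

  if-false : ∀ {b} {x y : ℕ} → b ≡ false → (if b then x else y) ≡ y
  if-false refl = refl

  -- The search loop of dist is local to its definition, so it can only be unfolded a fixed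
  -- number of times; 4 is the diameter of T(a,b).
  dist-from-reach : ∀ {n} (G : Graph n) u v d → d < n → d ≤ 4 →
    (∀ k → reach G k u v ≡ (d ≤ᵇ k)) → dist G u v ≡ d
  dist-from-reach G u v 0 (s≤s _) _ r = if-true (r 0)
  dist-from-reach G u v 1 (s≤s (s≤s _)) _ r = trans (if-false (r 0)) (if-true (r 1))
  dist-from-reach G u v 2 (s≤s (s≤s (s≤s _))) _ r =
    trans (if-false (r 0)) (trans (if-false (r 1)) (if-true (r 2)))
  dist-from-reach G u v 3 (s≤s (s≤s (s≤s (s≤s _)))) _ r =
    trans (if-false (r 0)) (trans (if-false (r 1)) (trans (if-false (r 2)) (if-true (r 3))))
  dist-from-reach G u v 4 (s≤s (s≤s (s≤s (s≤s (s≤s _))))) _ r =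
    trans (if-false (r 0)) (trans (if-false (r 1)) (trans (if-false (r 2))
      (trans (if-false (r 3)) (if-true (r 4)))))
  dist-from-reach G u v (suc (suc (suc (suc (suc _))))) _ (s≤s (s≤s (s≤s (s≤s ())))) _

  distMatrix-hollow : ∀ {n} (G : Graph n) → Hollow (distMatrix G)
  distMatrix-hollow {suc n} G u = cong +_ (if-true (eqFin-refl u))

  record IsDistanceFrom {n} (G : Graph n) (u : Fin n) (d : Fin n → ℕ) : Set where
    field
      zero-iff  : ∀ v → eqFin u v ≡ (d v ≤ᵇ 0)
      lipschitz : ∀ w v → adj G w v ≡ true → d v ≤ suc (d w)
      descent   : ∀ v → 0 < d v → Σ[ w ∈ Fin n ] adj G w v ≡ true × d w < d v

  module _ {n} {G : Graph n} {u : Fin n} {d : Fin n → ℕ} (isDist : IsDistanceFrom G u d) where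
    open IsDistanceFrom isDist

    reach-≡ : ∀ k v → reach G k u v ≡ (d v ≤ᵇ k)
    reach-≡ zero    v = zero-iff v
    reach-≡ (suc k) v = begin
      reach G k u v ∨ anyFin (λ w → reach G k u w ∧ adj G w v)
        ≡⟨ cong₂ _∨_ (reach-≡ k v) (anyFin-cong λ w → cong (_∧ adj G w v) (reach-≡ k w)) ⟩
      (d v ≤ᵇ k) ∨ anyFin within-k
        ≡⟨ step (ℕₚ.<-cmp (d v) (suc k)) ⟩
      (d v ≤ᵇ suc k) ∎
      where
      open ≡-Reasoning
      within-k : Fin n → Bool
      within-k w = (d w ≤ᵇ k) ∧ adj G w v
      step : Tri (d v < suc k) (d v ≡ suc k) (suc k < d v) → (d v ≤ᵇ k) ∨ anyFin within-k ≡ (d v ≤ᵇ suc k)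
      step (tri< dv≤k _ _) =
        trans (cong (_∨ anyFin within-k) (≤ᵇ-true (ℕₚ.≤-pred dv≤k))) (sym (≤ᵇ-true (ℕₚ.<⇒≤ dv≤k)))
      step (tri≈ _ dv≡1+k _) with descent v (subst (0 <_) (sym dv≡1+k) (s≤s z≤n))
      ... | w , w~v , dw<dv =
        trans (cong₂ _∨_ (≤ᵇ-false (ℕₚ.≤-reflexive (sym dv≡1+k))) (anyFin-true within-k w w-within-k))
              (sym (≤ᵇ-true (ℕₚ.≤-reflexive dv≡1+k)))
        where
        w-within-k : within-k w ≡ true
        w-within-k = cong₂ _∧_ (≤ᵇ-true (ℕₚ.≤-pred (subst (d w <_) dv≡1+k dw<dv))) w~v
      step (tri> _ _ 1+k<dv) =
        trans (cong₂ _∨_ (≤ᵇ-false (ℕₚ.<-trans (ℕₚ.n<1+n k) 1+k<dv)) (anyFin-false within-k none-within-k))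
              (sym (≤ᵇ-false 1+k<dv))
        where
        none-within-k : ∀ w → within-k w ≡ false
        none-within-k w with adj G w v in w~v
        ... | false = ∧-zeroʳ (d w ≤ᵇ k)
        ... | true  = cong (_∧ true) (≤ᵇ-false (ℕₚ.≤-pred (ℕₚ.≤-trans 1+k<dv (lipschitz w v w~v))))

    -- Descending from v meets every radius below d v, and distinct radii give distinct vertices.
    <-order : ∀ v → d v < n
    <-order v = Finₚ.injective⇒≤ {f = proj₁ ∘ layer} layer-injective
      where
      vertexAt : ∀ k g v → d v ≡ g ℕ.+ k → Σ[ w ∈ Fin n ] d w ≡ k
      vertexAt k zero    v dv≡k = v , dv≡k
      vertexAt k (suc g) v dv≡1+g+k with descent v (subst (0 <_) (sym dv≡1+g+k) (s≤s z≤n))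
      ... | w , w~v , dw<dv = vertexAt k g w (ℕₚ.≤-antisym
              (ℕₚ.≤-pred (subst (d w <_) dv≡1+g+k dw<dv))
              (ℕₚ.≤-pred (subst (_≤ suc (d w)) dv≡1+g+k (lipschitz w v w~v))))
      layer : (i : Fin (suc (d v))) → Σ[ w ∈ Fin n ] d w ≡ toℕ i
      layer i = vertexAt (toℕ i) (d v ℕ.∸ toℕ i) v (sym (ℕₚ.m∸n+n≡m (ℕₚ.≤-pred (Finₚ.toℕ<n i))))
      layer-injective : ∀ {i j} → proj₁ (layer i) ≡ proj₁ (layer j) → i ≡ j
      layer-injective {i} {j} eq =
        Finₚ.toℕ-injective (trans (sym (proj₂ (layer i))) (trans (cong d eq) (proj₂ (layer j))))

    dist-≡ : ∀ v → d v ≤ 4 → dist G u v ≡ d v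
    dist-≡ v dv≤4 = dist-from-reach G u v (d v) (<-order v) dv≤4 (λ k → reach-≡ k v)

open Distances

module TwoStars where

  open import Data.Nat using (_+_)
  open import Data.Fin using (_↑ˡ_; _↑ʳ_; splitAt; join)
  open import Data.Bool using (_∨_)
  import Data.Bool.Properties as Boolₚ
  import Data.Sum.Properties as Sumₚ
  open import Function.Bundles using (mk↔ₛ′)
  open import Relation.Nullary using (Dec; yes; no)
  open import Relation.Nullary.Decidable using (from-yes; map′; _×-dec_; _→-dec_)

  data Kind : Set where
    root centre₁ centre₂ leaf₁ leaf₂ : Kind

  all? : {P : Kind → Set} → (∀ c → Dec (P c)) → Dec (∀ c → P c)
  all? P? = map′
    (λ (r , c₁ , c₂ , l₁ , l₂) → λ { root → r ; centre₁ → c₁ ; centre₂ → c₂ ; leaf₁ → l₁ ; leaf₂ → l₂ })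
    (λ p → p root , p centre₁ , p centre₂ , p leaf₁ , p leaf₂)
    (P? root ×-dec P? centre₁ ×-dec P? centre₂ ×-dec P? leaf₁ ×-dec P? leaf₂)

  kindAt : ℕ → ℕ → Kind
  kindAt a 0                   = root
  kindAt a 1                   = centre₁
  kindAt a 2                   = centre₂
  kindAt a (suc (suc (suc x))) = if x <ᵇ a then leaf₁ else leaf₂

  kind : ∀ a b → Fin (3 + a + b) → Kind
  kind a b u = kindAt a (toℕ u)

  leafVertex : ∀ {n} → Fin n → Fin (3 + n)
  leafVertex i = suc (suc (suc i))

  kind-leaf₁ : ∀ a b i → kind a b (leafVertex (i ↑ˡ b)) ≡ leaf₁
  kind-leaf₁ a b i rewrite <ᵇ-true (subst (_< a) (sym (Finₚ.toℕ-↑ˡ i b)) (Finₚ.toℕ<n i)) = refl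

  kind-leaf₂ : ∀ a b j → kind a b (leafVertex (a ↑ʳ j)) ≡ leaf₂
  kind-leaf₂ a b j rewrite Finₚ.toℕ-↑ʳ a j | <ᵇ-false {a + toℕ j} {a} (ℕₚ.m≤m+n a (toℕ j)) = refl

  edgeK : Kind → Kind → Bool
  edgeK root    centre₁ = true
  edgeK root    centre₂ = true
  edgeK centre₁ leaf₁   = true
  edgeK centre₂ leaf₂   = true
  edgeK _       _       = false

  adjK : Kind → Kind → Bool
  adjK c c′ = edgeK c c′ ∨ edgeK c′ c

  -- The distance between two distinct vertices of the given kinds; two distinct vertices of
  -- one kind are leaves of one star (the diagonal entries of the one-vertex kinds are never used).
  distK : Kind → Kind → ℕ
  distK root    = λ { root → 2 ; centre₁ → 1 ; centre₂ → 1 ; leaf₁ → 2 ; leaf₂ → 2 }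
  distK centre₁ = λ { root → 1 ; centre₁ → 2 ; centre₂ → 2 ; leaf₁ → 1 ; leaf₂ → 3 }
  distK centre₂ = λ { root → 1 ; centre₁ → 2 ; centre₂ → 2 ; leaf₁ → 3 ; leaf₂ → 1 }
  distK leaf₁   = λ { root → 2 ; centre₁ → 1 ; centre₂ → 3 ; leaf₁ → 2 ; leaf₂ → 4 }
  distK leaf₂   = λ { root → 2 ; centre₁ → 3 ; centre₂ → 1 ; leaf₁ → 4 ; leaf₂ → 2 }

  centreKind : Fin 3 → Kind
  centreKind zero             = root
  centreKind (suc zero)       = centre₁
  centreKind (suc (suc zero)) = centre₂

  -- The centre next to a vertex of kind v on a shortest path from a vertex of kind u.
  towards : Kind → Kind → Fin 3
  towards u       centre₁ = zero
  towards u       centre₂ = zero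
  towards u       leaf₁   = suc zero
  towards u       leaf₂   = suc (suc zero)
  towards centre₁ root    = suc zero
  towards leaf₁   root    = suc zero
  towards _       root    = suc (suc zero)

  distK-positive : ∀ c c′ → 0 < distK c c′
  distK-positive = from-yes (all? λ c → all? λ c′ → 0 ℕₚ.<? distK c c′)

  distK-≤4 : ∀ c c′ → distK c c′ ≤ 4
  distK-≤4 = from-yes (all? λ c → all? λ c′ → distK c c′ ℕₚ.≤? 4)

  adjK⇒distK≤1 : ∀ c c′ → adjK c c′ ≡ true → distK c c′ ≤ 1
  adjK⇒distK≤1 = from-yes (all? λ c → all? λ c′ → (adjK c c′ Boolₚ.≟ true) →-dec (distK c c′ ℕₚ.≤? 1))

  distK≤1⇒adjK : ∀ c c′ → distK c c′ ≤ 1 → adjK c c′ ≡ true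
  distK≤1⇒adjK = from-yes (all? λ c → all? λ c′ → (distK c c′ ℕₚ.≤? 1) →-dec (adjK c c′ Boolₚ.≟ true))

  distK-lipschitz : ∀ c w v → adjK w v ≡ true → distK c v ≤ suc (distK c w)
  distK-lipschitz = from-yes (all? λ c → all? λ w → all? λ v →
    (adjK w v Boolₚ.≟ true) →-dec (distK c v ℕₚ.≤? suc (distK c w)))

  towards-descends : ∀ c v → 1 < distK c v →
    adjK (centreKind (towards c v)) v ≡ true × distK c (centreKind (towards c v)) < distK c v
  towards-descends = from-yes (all? λ c → all? λ v → (1 ℕₚ.<? distK c v) →-dec
    ((adjK (centreKind (towards c v)) v Boolₚ.≟ true)
     ×-dec (distK c (centreKind (towards c v)) ℕₚ.<? distK c v)))

  Tedge-kindAt : ∀ a b i j → j < 3 + a + b → Tedge a b i j ≡ edgeK (kindAt a i) (kindAt a j)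
  Tedge-kindAt a b 0 0 _ = refl
  Tedge-kindAt a b 0 1 _ = refl
  Tedge-kindAt a b 0 2 _ = refl
  Tedge-kindAt a b 0 (suc (suc (suc x))) _ with x <ᵇ a
  ... | true  = refl
  ... | false = refl
  Tedge-kindAt a b 1 0 _ = refl
  Tedge-kindAt a b 1 1 _ = refl
  Tedge-kindAt a b 1 2 _ = refl
  Tedge-kindAt a b 1 (suc (suc (suc x))) _ with x <ᵇ a
  ... | true  = refl
  ... | false = refl
  Tedge-kindAt a b 2 0 _ = refl
  Tedge-kindAt a b 2 1 _ = refl
  Tedge-kindAt a b 2 2 _ = refl
  Tedge-kindAt a b 2 (suc (suc (suc x))) (s≤s (s≤s (s≤s x<a+b))) rewrite <ᵇ-true x<a+b with x ℕₚ.<? a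
  ... | yes x<a rewrite <ᵇ-true x<a | <ᵇ-false {a} {suc x} x<a = refl
  ... | no  x≮a rewrite <ᵇ-false (ℕₚ.≮⇒≥ x≮a) | <ᵇ-true {a} {suc x} (s≤s (ℕₚ.≮⇒≥ x≮a)) = refl
  Tedge-kindAt a b (suc (suc (suc x))) j _ with x <ᵇ a
  ... | true  = refl
  ... | false = refl

  Tadj-kind : ∀ a b (u v : Fin (3 + a + b)) → Tadj a b u v ≡ adjK (kind a b u) (kind a b v)
  Tadj-kind a b u v = cong₂ _∨_ (Tedge-kindAt a b (toℕ u) (toℕ v) (Finₚ.toℕ<n v))
                                (Tedge-kindAt a b (toℕ v) (toℕ u) (Finₚ.toℕ<n u))

  dT : ∀ a b → Fin (3 + a + b) → Fin (3 + a + b) → ℕ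
  dT a b u v = if eqFin u v then 0 else distK (kind a b u) (kind a b v)

  dT-refl : ∀ a b u → dT a b u u ≡ 0
  dT-refl a b u rewrite eqFin-refl u = refl

  dT≤distK : ∀ a b u v → dT a b u v ≤ distK (kind a b u) (kind a b v)
  dT≤distK a b u v with eqFin u v
  ... | true  = z≤n
  ... | false = ℕₚ.≤-refl

  centre : ∀ a b → Fin 3 → Fin (3 + a + b)
  centre a b i = i ↑ˡ (a + b)

  kind-centre : ∀ a b i → kind a b (centre a b i) ≡ centreKind i
  kind-centre a b zero             = refl
  kind-centre a b (suc zero)       = refl
  kind-centre a b (suc (suc zero)) = refl

  isDistanceFrom-T : ∀ a b u → IsDistanceFrom (T a b) u (dT a b u)
  isDistanceFrom-T a b u = record { zero-iff = zero-iff ; lipschitz = lipschitz ; descent = descent }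
    where
    κ : Fin (3 + a + b) → Kind
    κ = kind a b
    zero-iff : ∀ v → eqFin u v ≡ (dT a b u v ≤ᵇ 0)
    zero-iff v with eqFin u v
    ... | true  = refl
    ... | false = sym (≤ᵇ-false (distK-positive (κ u) (κ v)))
    lipschitz : ∀ w v → Tadj a b w v ≡ true → dT a b u v ≤ suc (dT a b u w)
    lipschitz w v w~v with eqFin u v | eqFin u w in u≟w
    ... | true  | _     = z≤n
    ... | false | false = distK-lipschitz (κ u) (κ w) (κ v) (trans (sym (Tadj-kind a b w v)) w~v)
    ... | false | true  = adjK⇒distK≤1 (κ u) (κ v) (trans (sym (Tadj-kind a b u v)) u~v)
      where
      u~v : Tadj a b u v ≡ true
      u~v = subst (λ w → Tadj a b w v ≡ true) (sym (eqFin⇒≡ {u = u} {v = w} u≟w)) w~v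
    descent : ∀ v → 0 < dT a b u v → Σ[ w ∈ Fin (3 + a + b) ] Tadj a b w v ≡ true × dT a b u w < dT a b u v
    descent v 0<d with eqFin u v
    ... | true  = contradiction 0<d (ℕₚ.<-irrefl refl)
    ... | false with 1 ℕₚ.<? distK (κ u) (κ v)
    ...   | no  1≮d = u , trans (Tadj-kind a b u v) (distK≤1⇒adjK (κ u) (κ v) (ℕₚ.≮⇒≥ 1≮d))
                        , subst (_< distK (κ u) (κ v)) (sym (dT-refl a b u)) 0<d
    ...   | yes 1<d = w , w~v , ℕₚ.≤-<-trans (dT≤distK a b u w) closer
      where
      w = centre a b (towards (κ u) (κ v))
      w~v : Tadj a b w v ≡ true
      w~v = trans (Tadj-kind a b w v) (subst (λ c → adjK c (κ v) ≡ true) (sym (kind-centre a b _))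
                                             (proj₁ (towards-descends (κ u) (κ v) 1<d)))
      closer : distK (κ u) (κ w) < distK (κ u) (κ v)
      closer = subst (λ c → distK (κ u) c < distK (κ u) (κ v)) (sym (kind-centre a b _))
                     (proj₂ (towards-descends (κ u) (κ v) 1<d))

  dist-T : ∀ a b u v → dist (T a b) u v ≡ dT a b u v
  dist-T a b u v =
    dist-≡ (isDistanceFrom-T a b u) v (ℕₚ.≤-trans (dT≤distK a b u v) (distK-≤4 (kind a b u) (kind a b v)))

  swapK : Kind → Kind
  swapK root    = root
  swapK centre₁ = centre₂
  swapK centre₂ = centre₁
  swapK leaf₁   = leaf₂
  swapK leaf₂   = leaf₁

  adjK-swapK : ∀ c c′ → adjK (swapK c) (swapK c′) ≡ adjK c c′
  adjK-swapK = from-yes (all? λ c → all? λ c′ → adjK (swapK c) (swapK c′) Boolₚ.≟ adjK c c′)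

  swapFin : ∀ m n → Fin (m + n) → Fin (n + m)
  swapFin m n i = join n m (Sum.swap (splitAt m i))

  swapFin-involutive : ∀ m n i → swapFin n m (swapFin m n i) ≡ i
  swapFin-involutive m n i = begin
    join m n (Sum.swap (splitAt n (join n m (Sum.swap (splitAt m i)))))
      ≡⟨ cong (join m n ∘ Sum.swap) (Finₚ.splitAt-join n m (Sum.swap (splitAt m i))) ⟩
    join m n (Sum.swap (Sum.swap (splitAt m i)))
      ≡⟨ cong (join m n) (Sumₚ.swap-involutive (splitAt m i)) ⟩
    join m n (splitAt m i)
      ≡⟨ Finₚ.join-splitAt m n i ⟩
    i ∎
    where open ≡-Reasoning

  mirror : ∀ a b → Fin (3 + b + a) → Fin (3 + a + b)
  mirror a b zero                = zero
  mirror a b (suc zero)          = suc (suc zero)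
  mirror a b (suc (suc zero))    = suc zero
  mirror a b (suc (suc (suc i))) = leafVertex (swapFin b a i)

  mirror-involutive : ∀ a b u → mirror b a (mirror a b u) ≡ u
  mirror-involutive a b zero                = refl
  mirror-involutive a b (suc zero)          = refl
  mirror-involutive a b (suc (suc zero))    = refl
  mirror-involutive a b (suc (suc (suc i))) = cong leafVertex (swapFin-involutive b a i)

  kind-mirror : ∀ a b u → kind a b (mirror a b u) ≡ swapK (kind b a u)
  kind-mirror a b zero                = refl
  kind-mirror a b (suc zero)          = refl
  kind-mirror a b (suc (suc zero))    = refl
  kind-mirror a b (suc (suc (suc i))) with splitAt b i in i≡
  ... | inj₁ i′ = begin
    kind a b (leafVertex (a ↑ʳ i′))         ≡⟨ kind-leaf₂ a b i′ ⟩
    swapK leaf₁                             ≡⟨ cong swapK (kind-leaf₁ b a i′) ⟨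
    swapK (kind b a (leafVertex (i′ ↑ˡ a))) ≡⟨ cong (swapK ∘ kind b a ∘ leafVertex) (Finₚ.splitAt⁻¹-↑ˡ i≡) ⟩
    swapK (kind b a (leafVertex i))         ∎
    where open ≡-Reasoning
  ... | inj₂ j = begin
    kind a b (leafVertex (j ↑ˡ b))          ≡⟨ kind-leaf₁ a b j ⟩
    swapK leaf₂                             ≡⟨ cong swapK (kind-leaf₂ b a j) ⟨
    swapK (kind b a (leafVertex (b ↑ʳ j)))  ≡⟨ cong (swapK ∘ kind b a ∘ leafVertex) (Finₚ.splitAt⁻¹-↑ʳ i≡) ⟩
    swapK (kind b a (leafVertex i))         ∎
    where open ≡-Reasoning

  T-mirror : ∀ a b → T b a ≅ T a b
  T-mirror a b = mk↔ₛ′ (mirror a b) (mirror b a) (mirror-involutive b a) (mirror-involutive a b) , preserves-adj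
    where
    preserves-adj : ∀ u v → Tadj b a u v ≡ Tadj a b (mirror a b u) (mirror a b v)
    preserves-adj u v = begin
      Tadj b a u v
        ≡⟨ Tadj-kind b a u v ⟩
      adjK (kind b a u) (kind b a v)
        ≡⟨ adjK-swapK (kind b a u) (kind b a v) ⟨
      adjK (swapK (kind b a u)) (swapK (kind b a v))
        ≡⟨ cong₂ adjK (kind-mirror a b u) (kind-mirror a b v) ⟨
      adjK (kind a b (mirror a b u)) (kind a b (mirror a b v))
        ≡⟨ Tadj-kind a b (mirror a b u) (mirror a b v) ⟨
      Tadj a b (mirror a b u) (mirror a b v) ∎
      where open ≡-Reasoning

open TwoStars

module TwoStarsTrace where

  open import Data.Integer using (_+_; _*_; _-_)
  open import Data.Fin using (_↑ˡ_; _↑ʳ_)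

  weighted : ℕ → ℕ → (Kind → ℤ) → ℤ
  weighted a b h = h root + (h centre₁ + (h centre₂ + (+ a * h leaf₁ + + b * h leaf₂)))

  sumFin-kind : ∀ a b (h : Kind → ℤ) → sumFin (λ u → h (kind a b u)) ≡ weighted a b h
  sumFin-kind a b h = cong (λ s → h root + (h centre₁ + (h centre₂ + s))) (begin
    sumFin (λ i → h (kind a b (leafVertex i)))
      ≡⟨ sumFin-↑ a (λ i → h (kind a b (leafVertex i))) ⟩
    sumFin (λ i → h (kind a b (leafVertex (i ↑ˡ b)))) + sumFin (λ j → h (kind a b (leafVertex (a ↑ʳ j))))
      ≡⟨ cong₂ _+_ (sumFin-cong {a} (cong h ∘ kind-leaf₁ a b)) (sumFin-cong {b} (cong h ∘ kind-leaf₂ a b)) ⟩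
    sumFin {a} (λ _ → h leaf₁) + sumFin {b} (λ _ → h leaf₂)
      ≡⟨ cong₂ _+_ (sumFin-const a (h leaf₁)) (sumFin-const b (h leaf₂)) ⟩
    + a * h leaf₁ + + b * h leaf₂ ∎)
    where open ≡-Reasoning

  squaredDistK : Kind → Kind → ℤ
  squaredDistK c c′ = + distK c c′ * + distK c′ c

  distMatrix-T-product : ∀ a b u v → distMatrix (T a b) u v * distMatrix (T a b) v u
    ≡ (if eqFin u v then + 0 else squaredDistK (kind a b u) (kind a b v))
  distMatrix-T-product a b u v rewrite dist-T a b u v | dist-T a b v u | ≡ᵇ-sym (toℕ v) (toℕ u) with eqFin u v
  ... | true  = refl
  ... | false = refl

  traceOfSquare-T-kinds : ∀ a b → traceOfSquare (distMatrix (T a b)) ≡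
    weighted a b (λ c → weighted a b (squaredDistK c)) - weighted a b (λ c → squaredDistK c c)
  traceOfSquare-T-kinds a b = begin
    sumFin (λ u → sumFin (λ v → distMatrix (T a b) u v * distMatrix (T a b) v u))
      ≡⟨ sumFin-cong (λ u → trans (sumFin-cong (distMatrix-T-product a b u)) (sumFin-punctured u (sq u))) ⟩
    sumFin (λ u → sumFin (sq u) - sq u u)
      ≡⟨ trans (sumFin-+ (λ u → sumFin (sq u)) (λ u → - sq u u))
               (cong (_+_ (sumFin (λ u → sumFin (sq u)))) (sumFin-neg (λ u → sq u u))) ⟩
    sumFin (λ u → sumFin (sq u)) - sumFin (λ u → sq u u)
      ≡⟨ cong₂ _-_ (trans (sumFin-cong λ u → sumFin-kind a b (squaredDistK (kind a b u)))
                          (sumFin-kind a b (λ c → weighted a b (squaredDistK c))))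
                   (sumFin-kind a b (λ c → squaredDistK c c)) ⟩
    weighted a b (λ c → weighted a b (squaredDistK c)) - weighted a b (λ c → squaredDistK c c) ∎
    where
    open ≡-Reasoning
    sq : Fin (3 ℕ.+ a ℕ.+ b) → Fin (3 ℕ.+ a ℕ.+ b) → ℤ
    sq u v = squaredDistK (kind a b u) (kind a b v)

  traceOfSquare-T : ∀ a b → traceOfSquare (distMatrix (T a b)) ≡
    + 12 + + 24 * (+ a + + b) + + 4 * ((+ a + + b) * (+ a + + b)) + + 24 * (+ a * + b)
  traceOfSquare-T a b = trans (traceOfSquare-T-kinds a b) (polynomial (+ a) (+ b))
    where
    -- The normal form of the right-hand side of traceOfSquare-T-kinds: the line of kind c lists
    -- squaredDistK c c′ for c′ = root, centre₁, centre₂, leaf₁, leaf₂; the last line is the diagonal.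
    polynomial : ∀ A B →
        (+ 4 + (+ 1 + (+ 1 + (A * + 4 + B * + 4))))
      + ((+ 1 + (+ 4 + (+ 4 + (A * + 1 + B * + 9))))
      + ((+ 1 + (+ 4 + (+ 4 + (A * + 9 + B * + 1))))
      + (A * (+ 4 + (+ 1 + (+ 9 + (A * + 4 + B * + 16))))
      +  B * (+ 4 + (+ 9 + (+ 1 + (A * + 16 + B * + 4)))))))
      - (+ 4 + (+ 4 + (+ 4 + (A * + 4 + B * + 4))))
      ≡ + 12 + + 24 * (A + B) + + 4 * ((A + B) * (A + B)) + + 24 * (A * B)
    polynomial = solve-∀

open TwoStarsTrace

sum-product-unique : ∀ (x y x′ y′ : ℤ) → x′ ℤ.+ y′ ≡ x ℤ.+ y → x′ ℤ.* y′ ≡ x ℤ.* y →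
  (x′ ≡ x × y′ ≡ y) ⊎ (x′ ≡ y × y′ ≡ x)
sum-product-unique x y x′ y′ sum≡ product≡ = fromRoot (ℤₚ.i*j≡0⇒i≡0∨j≡0 (x′ - x) x′-isRoot)
  where
  open ≡-Reasoning
  open import Data.Integer using (_+_; _*_; _-_)
  expand : ∀ x y z → (z - x) * (z - y) ≡ z * z - z * (x + y) + x * y
  expand = solve-∀
  vanish : ∀ z w → z * z - z * (z + w) + z * w ≡ + 0
  vanish = solve-∀
  x′-isRoot : (x′ - x) * (x′ - y) ≡ + 0
  x′-isRoot = begin
    (x′ - x) * (x′ - y)                 ≡⟨ expand x y x′ ⟩
    x′ * x′ - x′ * (x + y) + x * y      ≡⟨ cong₂ (λ s p → x′ * x′ - x′ * s + p) sum≡ product≡ ⟨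
    x′ * x′ - x′ * (x′ + y′) + x′ * y′  ≡⟨ vanish x′ y′ ⟩
    + 0                                 ∎
  fromRoot : x′ - x ≡ + 0 ⊎ x′ - y ≡ + 0 → (x′ ≡ x × y′ ≡ y) ⊎ (x′ ≡ y × y′ ≡ x)
  fromRoot (inj₁ x′-x≡0) = inj₁ (x′≡x , +-cancelˡ x y′ y (trans (cong (_+ y′) (sym x′≡x)) sum≡))
    where
    x′≡x : x′ ≡ x
    x′≡x = ℤₚ.i-j≡0⇒i≡j x′ x x′-x≡0
  fromRoot (inj₂ x′-y≡0) =
    inj₂ (x′≡y , +-cancelˡ y y′ x (trans (cong (_+ y′) (sym x′≡y)) (trans sum≡ (ℤₚ.+-comm x y))))
    where
    x′≡y : x′ ≡ y
    x′≡y = ℤₚ.i-j≡0⇒i≡j x′ y x′-y≡0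

product-from-trace : ∀ a b a′ b′ → + a′ ℤ.+ + b′ ≡ + a ℤ.+ + b →
  traceOfSquare (distMatrix (T a′ b′)) ≡ traceOfSquare (distMatrix (T a b)) → + a′ ℤ.* + b′ ≡ + a ℤ.* + b
product-from-trace a b a′ b′ sum≡ trace≡ =
  ℤₚ.*-cancelˡ-≡ (+ 24) (+ a′ * + b′) (+ a * + b) (+-cancelˡ (+ 12 + + 24 * s + + 4 * (s * s)) _ _ (begin
    + 12 + + 24 * s + + 4 * (s * s) + + 24 * (+ a′ * + b′)
      ≡⟨ cong (λ s → + 12 + + 24 * s + + 4 * (s * s) + + 24 * (+ a′ * + b′)) sum≡ ⟨
    + 12 + + 24 * s′ + + 4 * (s′ * s′) + + 24 * (+ a′ * + b′)
      ≡⟨ traceOfSquare-T a′ b′ ⟨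
    traceOfSquare (distMatrix (T a′ b′))
      ≡⟨ trace≡ ⟩
    traceOfSquare (distMatrix (T a b))
      ≡⟨ traceOfSquare-T a b ⟩
    + 12 + + 24 * s + + 4 * (s * s) + + 24 * (+ a * + b) ∎))
  where
  open ≡-Reasoning
  open import Data.Integer using (_+_; _*_)
  s s′ : ℤ
  s = + a + + b
  s′ = + a′ + + b′

T-≅-up-to-swap : ∀ {a b a′ b′} → (a′ ≡ a × b′ ≡ b) ⊎ (a′ ≡ b × b′ ≡ a) → T a′ b′ ≅ T a b
T-≅-up-to-swap {a} {b} (inj₁ (refl , refl)) = ↔-id (Fin (3 ℕ.+ a ℕ.+ b)) , λ _ _ → refl
T-≅-up-to-swap {a} {b} (inj₂ (refl , refl)) = T-mirror a b

mainTheorem2 : (a b a′ b′ : ℕ) → DCospectral (T a′ b′) (T a b) → T a′ b′ ≅ T a b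
mainTheorem2 a b a′ b′ (order≡ , χ≡) = T-≅-up-to-swap (Sum.map +-injective² +-injective² parameters)
  where
  +-injective² : ∀ {m n m′ n′} → + m ≡ + m′ × + n ≡ + n′ → m ≡ m′ × n ≡ n′
  +-injective² = Product.map ℤₚ.+-injective ℤₚ.+-injective
  sum≡ : + a′ ℤ.+ + b′ ≡ + a ℤ.+ + b
  sum≡ = cong (λ n → + (n ℕ.∸ 3)) order≡
  trace≡ : traceOfSquare (distMatrix (T a′ b′)) ≡ traceOfSquare (distMatrix (T a b))
  trace≡ = charPoly≡⇒traceOfSquare≡ (distMatrix (T a′ b′)) (distMatrix (T a b)) (cong (ℕ._∸ 2) order≡)
             (distMatrix-hollow (T a′ b′)) (distMatrix-hollow (T a b)) χ≡
  parameters : (+ a′ ≡ + a × + b′ ≡ + b) ⊎ (+ a′ ≡ + b × + b′ ≡ + a)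
  parameters = sum-product-unique (+ a) (+ b) (+ a′) (+ b′) sum≡ (product-from-trace a b a′ b′ sum≡ trace≡)
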